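{- For every positive integer $n$, the graphs $I_{\alpha(P_{3n-1})}(P_{3n-1})$ and $I_{\alpha(P_{3n})}(P_{3n})$ are not Hamiltonian; for every integer $n\ge 3$ the graph $I_{\alpha(C_n)}(C_n)$ is not Hamiltonian; and for every integer $n\ge 4$ the graph $I_{\alpha(W_n)}(W_n)$ is not Hamiltonian.
   Context: $P_m$ is the path on $m$ vertices, $C_m$ the cycle on $m$ vertices, and $W_m$ the wheel on $m$ vertices, i.e. the join $K_1 + C_{m-1}$ of a single vertex with a cycle on $m-1$ vertices. For a simple graph $G=(V,E)$, a set $I\subseteq V$ is independent if no two of its vertices are adjacent; the empty set is independent. $\alpha(G)$ denotes the maximum cardinality of an independent set. For a non-negative integer $k$, the $k$-independent graph $I_k(G)$ is the graph whose vertices are the independent sets of $G$ (including $\emptyset$) of cardinality at most $k$, two such sets being adjacent if and only if one is obtained from the other by adding or deleting a single vertex of $G$. -}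

module Defs where

open import Data.Nat using (ℕ; zero; suc; _≤_; _∸_)
open import Data.Fin using (Fin; toℕ)
open import Data.Fin.Subset using (Subset; _∈_; _∉_; _∪_; ⁅_⁆; ∣_∣)
open import Data.Product using (Σ; ∃; _×_; _,_)
open import Data.Sum using (_⊎_)
open import Relation.Nullary using (¬_)
open import Relation.Binary.PropositionalEquality using (_≡_)
open import Function.Definitions using (Injective)

AdjRel : ℕ → Set₁
AdjRel m = Fin m → Fin m → Set

Consec : ℕ → ℕ → Set
Consec a b = suc a ≡ b ⊎ suc b ≡ a

pathAdj : (m : ℕ) → AdjRel m
pathAdj m i j = Consec (toℕ i) (toℕ j)

-- Cycle C_m (meaningful for m ≥ 3): path edges plus the edge {0, m-1}
cycleAdj : (m : ℕ) → AdjRel m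
cycleAdj m i j =
  Consec (toℕ i) (toℕ j)
  ⊎ (toℕ i ≡ 0 × suc (toℕ j) ≡ m)
  ⊎ (toℕ j ≡ 0 × suc (toℕ i) ≡ m)

-- Wheel W_m = K_1 + C_{m-1} (meaningful for m ≥ 4): vertex 0 is the hub,
-- adjacent to all others; vertices 1,…,m-1 form a cycle
-- (consecutive ones adjacent, plus the edge {1, m-1}).
wheelAdj : (m : ℕ) → AdjRel m
wheelAdj m i j =
  (toℕ i ≡ 0 × ¬ toℕ j ≡ 0)
  ⊎ (toℕ j ≡ 0 × ¬ toℕ i ≡ 0)
  ⊎ (¬ toℕ i ≡ 0 × ¬ toℕ j ≡ 0 × Consec (toℕ i) (toℕ j))
  ⊎ (toℕ i ≡ 1 × suc (toℕ j) ≡ m)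
  ⊎ (toℕ j ≡ 1 × suc (toℕ i) ≡ m)

Independent : {m : ℕ} → AdjRel m → Subset m → Set
Independent {m} adj S = (i j : Fin m) → i ∈ S → j ∈ S → ¬ adj i j

IsIndependenceNumber : {m : ℕ} → AdjRel m → ℕ → Set
IsIndependenceNumber {m} adj a =
  (Σ (Subset m) λ S → Independent adj S × ∣ S ∣ ≡ a)
  × ((S : Subset m) → Independent adj S → ∣ S ∣ ≤ a)

-- Graphs whose vertex set is carved out of a carrier by a predicate
-- (vertex identity = equality in the carrier).

record Graph : Set₁ where
  field
    Carrier  : Set
    IsVertex : Carrier → Set
    Adj      : Carrier → Carrier → Set

Hamiltonian : Graph → Set
Hamiltonian G =
  Σ ℕ λ N → 3 ≤ N × Σ (Fin N → Carrier) λ f →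
      ((i : Fin N) → IsVertex (f i))
    × Injective _≡_ _≡_ f
    × ((v : Carrier) → IsVertex v → ∃ λ i → f i ≡ v)
    × ((i j : Fin N) →
         (suc (toℕ i) ≡ toℕ j ⊎ (suc (toℕ i) ≡ N × toℕ j ≡ 0)) →
         Adj (f i) (f j))
  where open Graph G

-- The k-independent graph I_k(G): vertices are independent sets of size
-- at most k (including ∅); S ~ T iff one arises from the other by adding
-- a single vertex of G.

AddOne : {m : ℕ} → Subset m → Subset m → Set
AddOne {m} S T = Σ (Fin m) λ x → x ∉ S × T ≡ S ∪ ⁅ x ⁆

kIndependentGraph : {m : ℕ} → ℕ → AdjRel m → Graph
kIndependentGraph {m} k adj = record
  { Carrier  = Subset m
  ; IsVertex = λ S → Independent adj S × ∣ S ∣ ≤ k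
  ; Adj      = λ S T → AddOne S T ⊎ AddOne T S
  }

-- Adjacent vertices of I_k(G) differ by one element, so the sign (-1)^|S| alternates along every
-- edge. When k ≥ α(G) the vertices of I_k(G) are all the independent sets of G, so a Hamiltonian
-- cycle pairs them off into sets of opposite sign and forces I(G; -1) = Σ_S (-1)^|S| to vanish.
-- For paths, splitting on the first vertex gives I(P_{m+2}; -1) = I(P_{m+1}; -1) - I(P_m; -1), so
-- the values 1, 0, -1, -1, 0, 1 repeat with period 6 and vanish only for m ≡ 1 (mod 3). For cycles,
-- splitting on vertex 0 gives I(C_{m+3}; -1) = I(P_{m+2}; -1) - J(m+1), where J(k) is the same
-- signed count over the independent sets of P_k avoiding its last vertex; J obeys the same
-- recurrence, and the resulting sequence -2, -1, 1, 2, 1, -1, ... never vanishes. The wheel needs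
-- no counting: its hub h is adjacent to every other vertex, so in I_α(W_n) the vertex {h} has ∅ as
-- its only neighbour, and a vertex on a Hamiltonian cycle has two distinct neighbours.
module Submission where

open import Defs
import Data.Bool as Bool
open import Data.Bool using (Bool; true; false; if_then_else_; _∧_; not)
open import Data.Bool.Properties using (∧-conicalˡ; ∧-conicalʳ; ¬-not; if-float)
open import Data.Empty using (⊥; ⊥-elim)
open import Data.Fin using (Fin; zero; suc; toℕ; inject₁; fromℕ; fromℕ<; punchIn)
open import Data.Fin.Properties
  using (toℕ-injective; toℕ-fromℕ<; toℕ<n; toℕ-inject₁; toℕ-fromℕ; punchInᵢ≢i)
open import Data.Fin.Subset
  using (Subset; inside; outside; _∈_; _∉_; _⊆_; _∪_; ⁅_⁆; ∣_∣) renaming (⊥ to ∅)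
open import Data.Fin.Subset.Properties
  using (∪-identityʳ; x∈⁅y⁆⇒x≡y; x∈⁅x⁆; x∉⁅y⁆⇒x≢y; p⊆p∪q; q⊆p∪q; ⊆-antisym; ⊥⊆)
open import Data.Integer using (ℤ; 0ℤ; 1ℤ; -_; _+_; _-_; +0; +[1+_]; -[1+_])
open import Data.Integer.Properties
  using (+-0-commutativeMonoid; neg-distrib-+; neg-involutive; neg-injective; +-comm; +-identityʳ; +-identityˡ)
open import Data.Integer.Tactic.RingSolver using (solve-∀)
open import Data.Nat as ℕ using (ℕ; zero; suc; _≤_; _*_; _∸_)
import Data.Nat.Properties as ℕ
open import Data.Nat.Properties using (suc-injective)
open import Data.Nat.DivMod using (_/_; _%_; m≡m%n+[m/n]*n; m%n<n)
open import Data.Product using (∃; _,_; _×_)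
import Data.Sum as Sum
open import Data.Sum using (_⊎_; inj₁; inj₂)
open import Data.Vec using (_∷_; []; here; there)
open import Data.Vec.Properties using (≡-dec)
open import Function using (_∘_; _⇔_; Equivalence; mk⇔)
open import Function.Definitions using (Injective)
open import Relation.Nullary using (¬_; contradiction; Dec; does; yes; no)
open import Relation.Nullary.Decidable using (dec-true; dec-false)
open import Relation.Binary.Definitions using (DecidableEquality)
open import Relation.Binary.PropositionalEquality
open import Algebra.Properties.CommutativeMonoid.Sum +-0-commutativeMonoid
  using (sum; sum-cong-≗; ∑-distrib-+; sum-remove; sum-replicate-zero; sum-init-last)

private variable
  m N : ℕ

sgn : Subset m → ℤ
sgn [] = 1ℤ
sgn (outside ∷ S) = sgn S
sgn (inside ∷ S) = - sgn S

sgn-∪⁅⁆ : (S : Subset m) (x : Fin m) → x ∉ S → sgn (S ∪ ⁅ x ⁆) ≡ - sgn S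
sgn-∪⁅⁆ (inside ∷ S) zero x∉S = ⊥-elim (x∉S here)
sgn-∪⁅⁆ (outside ∷ S) zero _ = cong (-_ ∘ sgn) (∪-identityʳ S)
sgn-∪⁅⁆ (inside ∷ S) (suc x) x∉S = cong -_ (sgn-∪⁅⁆ S x (x∉S ∘ there))
sgn-∪⁅⁆ (outside ∷ S) (suc x) x∉S = sgn-∪⁅⁆ S x (x∉S ∘ there)

sgn-AddOne : (S T : Subset m) → AddOne S T → sgn T ≡ - sgn S
sgn-AddOne S _ (x , x∉S , refl) = sgn-∪⁅⁆ S x x∉S

sgn-adjacent : (S T : Subset m) → AddOne S T ⊎ AddOne T S → sgn T ≡ - sgn S
sgn-adjacent S T (inj₁ S→T) = sgn-AddOne S T S→T
sgn-adjacent S T (inj₂ T→S) = trans (sym (neg-involutive (sgn T))) (cong -_ (sym (sgn-AddOne T S T→S)))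

∑ₛ : (Subset m → ℤ) → ℤ
∑ₛ {zero} g = g []
∑ₛ {suc m} g = ∑ₛ (g ∘ (outside ∷_)) + ∑ₛ (g ∘ (inside ∷_))

∑ₛ-cong : {g h : Subset m → ℤ} → (∀ S → g S ≡ h S) → ∑ₛ g ≡ ∑ₛ h
∑ₛ-cong {zero} g≗h = g≗h []
∑ₛ-cong {suc m} g≗h = cong₂ _+_ (∑ₛ-cong (g≗h ∘ (outside ∷_))) (∑ₛ-cong (g≗h ∘ (inside ∷_)))

∑ₛ-zero : ∑ₛ {m} (λ _ → 0ℤ) ≡ 0ℤ
∑ₛ-zero {zero} = refl
∑ₛ-zero {suc m} = cong₂ _+_ (∑ₛ-zero {m}) (∑ₛ-zero {m})

∑ₛ-neg : (g : Subset m → ℤ) → ∑ₛ (λ S → - g S) ≡ - ∑ₛ g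
∑ₛ-neg {zero} g = refl
∑ₛ-neg {suc m} g = trans (cong₂ _+_ (∑ₛ-neg (g ∘ (outside ∷_))) (∑ₛ-neg (g ∘ (inside ∷_))))
                         (sym (neg-distrib-+ (∑ₛ (g ∘ (outside ∷_))) (∑ₛ (g ∘ (inside ∷_)))))

∑ₛ-sum : (h : Fin N → Subset m → ℤ) → ∑ₛ (λ S → sum (λ i → h i S)) ≡ sum (λ i → ∑ₛ (h i))
∑ₛ-sum {m = zero} h = refl
∑ₛ-sum {m = suc m} h =
  trans (cong₂ _+_ (∑ₛ-sum (λ i → h i ∘ (outside ∷_))) (∑ₛ-sum (λ i → h i ∘ (inside ∷_))))
        (sym (∑-distrib-+ (λ i → ∑ₛ (h i ∘ (outside ∷_))) (λ i → ∑ₛ (h i ∘ (inside ∷_)))))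

_≟ₛ_ : DecidableEquality (Subset m)
_≟ₛ_ = ≡-dec Bool._≟_

∑ₛ-δ : (T : Subset m) (g : Subset m → ℤ) → ∑ₛ (λ S → if does (S ≟ₛ T) then g S else 0ℤ) ≡ g T
∑ₛ-δ [] g = refl
∑ₛ-δ {suc m} (outside ∷ T) g =
  trans (cong₂ _+_ (∑ₛ-δ T (g ∘ (outside ∷_))) (∑ₛ-zero {m})) (+-identityʳ (g (outside ∷ T)))
∑ₛ-δ {suc m} (inside ∷ T) g =
  trans (cong₂ _+_ (∑ₛ-zero {m}) (∑ₛ-δ T (g ∘ (inside ∷_)))) (+-identityˡ (g (inside ∷ T)))

sum-zero : (s : Fin N → ℤ) → (∀ i → s i ≡ 0ℤ) → sum s ≡ 0ℤ
sum-zero {N} s s≗0 = trans (sum-cong-≗ s≗0) (sum-replicate-zero N)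

sum-neg : (s : Fin N → ℤ) → sum (λ i → - s i) ≡ - sum s
sum-neg {zero} s = refl
sum-neg {suc N} s =
  trans (cong ((- s zero) +_) (sum-neg (s ∘ suc))) (sym (neg-distrib-+ (s zero) (sum (s ∘ suc))))

sum-indicator-unique : {Q : Fin N → Set} (Q? : ∀ i → Dec (Q i)) (i₀ : Fin N) (c : ℤ) →
  Q i₀ → (∀ i → Q i → i ≡ i₀) → sum (λ i → if does (Q? i) then c else 0ℤ) ≡ c
sum-indicator-unique {suc N} Q? i₀ c Qi₀ unique = begin
  sum t                        ≡⟨ sum-remove {i = i₀} t ⟩
  t i₀ + sum (t ∘ punchIn i₀)  ≡⟨ cong₂ _+_ (cong (λ b → if b then c else 0ℤ) (dec-true (Q? i₀) Qi₀))
                                            (sum-zero _ vanishes-off-i₀) ⟩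
  c + 0ℤ                       ≡⟨ +-identityʳ c ⟩
  c                            ∎
  where
  open ≡-Reasoning
  t = λ i → if does (Q? i) then c else 0ℤ
  vanishes-off-i₀ : ∀ j → t (punchIn i₀ j) ≡ 0ℤ
  vanishes-off-i₀ j rewrite dec-false (Q? (punchIn i₀ j)) (punchInᵢ≢i i₀ j ∘ unique _) = refl

sum-indicator-none : {Q : Fin N → Set} (Q? : ∀ i → Dec (Q i)) (c : ℤ) →
  (∀ i → ¬ Q i) → sum (λ i → if does (Q? i) then c else 0ℤ) ≡ 0ℤ
sum-indicator-none Q? c ¬Q = sum-zero _ (λ i → cong (λ b → if b then c else 0ℤ) (dec-false (Q? i) (¬Q i)))

∑ₛ-reindex : (f : Fin N → Subset m) → Injective _≡_ _≡_ f → (P : Subset m → Bool) →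
  (∀ i → P (f i) ≡ true) → (∀ S → P S ≡ true → ∃ λ i → f i ≡ S) →
  (g : Subset m → ℤ) → ∑ₛ (λ S → if P S then g S else 0ℤ) ≡ sum (g ∘ f)
∑ₛ-reindex f f-inj P P-image image-P g = begin
  ∑ₛ (λ S → if P S then g S else 0ℤ)  ≡⟨ ∑ₛ-cong count-preimage ⟩
  ∑ₛ (λ S → sum (λ i → δ i S))        ≡⟨ ∑ₛ-sum δ ⟩
  sum (λ i → ∑ₛ (δ i))                ≡⟨ sum-cong-≗ (λ i → ∑ₛ-δ (f i) g) ⟩
  sum (g ∘ f)                         ∎
  where
  open ≡-Reasoning
  δ = λ i S → if does (S ≟ₛ f i) then g S else 0ℤ
  count-preimage : ∀ S → (if P S then g S else 0ℤ) ≡ sum (λ i → δ i S)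
  count-preimage S with P S in PS
  ... | true  = let i₀ , fi₀≡S = image-P S PS in
    sym (sum-indicator-unique (λ i → S ≟ₛ f i) i₀ (g S) (sym fi₀≡S)
                              (λ i S≡fi → f-inj (trans (sym S≡fi) (sym fi₀≡S))))
  ... | false = sym (sum-indicator-none (λ i → S ≟ₛ f i) (g S)
    (λ i S≡fi → contradiction (trans (sym (P-image i)) (trans (cong P (sym S≡fi)) PS)) λ ()))

i≡-i⇒i≡0 : ∀ {i} → i ≡ - i → i ≡ 0ℤ
i≡-i⇒i≡0 {+0} _ = refl
i≡-i⇒i≡0 {+[1+ _ ]} ()
i≡-i⇒i≡0 { -[1+ _ ]} ()

CyclicSucc : (N : ℕ) → Fin N → Fin N → Set
CyclicSucc N i j = suc (toℕ i) ≡ toℕ j ⊎ (suc (toℕ i) ≡ N × toℕ j ≡ 0)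

-- Shifting the cycle by one position negates the sum.
sum-alternating : (s : Fin N → ℤ) → (∀ i j → CyclicSucc N i j → s j ≡ - s i) → sum s ≡ 0ℤ
sum-alternating {zero} s alt = refl
sum-alternating {suc N} s alt = i≡-i⇒i≡0 (begin
  s zero + sum (s ∘ suc)               ≡⟨ cong₂ _+_ (alt (fromℕ N) zero (inj₂ (cong suc (toℕ-fromℕ N) , refl)))
                                                    (trans (sum-cong-≗ step) (sum-neg (s ∘ inject₁))) ⟩
  - s (fromℕ N) + - sum (s ∘ inject₁)  ≡⟨ sym (neg-distrib-+ (s (fromℕ N)) _) ⟩
  - (s (fromℕ N) + sum (s ∘ inject₁))  ≡⟨ cong -_ (+-comm (s (fromℕ N)) _) ⟩
  - (sum (s ∘ inject₁) + s (fromℕ N))  ≡⟨ cong -_ (sym (sum-init-last s)) ⟩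
  - (s zero + sum (s ∘ suc))           ∎)
  where
  open ≡-Reasoning
  step : ∀ i → s (suc i) ≡ - s (inject₁ i)
  step i = alt (inject₁ i) (suc i) (inj₁ (cong suc (toℕ-inject₁ i)))

hamiltonian⇒alternating-sum≡0 : {V : Subset m → Set} {E : Subset m → Subset m → Set}
  (σ : Subset m → ℤ) → (∀ S T → E S T → σ T ≡ - σ S) →
  (P : Subset m → Bool) → (∀ S → V S → P S ≡ true) → (∀ S → P S ≡ true → V S) →
  Hamiltonian (record { Carrier = Subset m ; IsVertex = V ; Adj = E }) →
  ∑ₛ (λ S → if P S then σ S else 0ℤ) ≡ 0ℤ
hamiltonian⇒alternating-sum≡0 σ alternates P V⇒P P⇒V (_ , _ , f , f-vertex , f-inj , f-onto , f-cycle) = begin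
  ∑ₛ (λ S → if P S then σ S else 0ℤ)  ≡⟨ ∑ₛ-reindex f f-inj P (λ i → V⇒P (f i) (f-vertex i))
                                                    (λ S PS → f-onto S (P⇒V S PS)) σ ⟩
  sum (σ ∘ f)                         ≡⟨ sum-alternating (σ ∘ f) (λ i j i→j → alternates (f i) (f j) (f-cycle i j i→j)) ⟩
  0ℤ                                  ∎
  where open ≡-Reasoning

-- When P decides independence in G, signedCount P is the independence polynomial of G at -1.
signedCount : (Subset m → Bool) → ℤ
signedCount P = ∑ₛ (λ S → if P S then sgn S else 0ℤ)

hamiltonian⇒signedCount≡0 : (adj : AdjRel m) (a : ℕ) (P : Subset m → Bool) →
  (∀ S → P S ≡ true ⇔ Independent adj S) → (∀ S → Independent adj S → ∣ S ∣ ≤ a) →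
  Hamiltonian (kIndependentGraph a adj) → signedCount P ≡ 0ℤ
hamiltonian⇒signedCount≡0 adj a P P⇔independent α≤a =
  hamiltonian⇒alternating-sum≡0 sgn sgn-adjacent P
    (λ S (S-independent , _) → Equivalence.from (P⇔independent S) S-independent)
    (λ S PS → let S-independent = Equivalence.to (P⇔independent S) PS in S-independent , α≤a S S-independent)

signedCount-cong : {P Q : Subset m → Bool} → (∀ S → P S ≡ Q S) → signedCount P ≡ signedCount Q
signedCount-cong P≗Q = ∑ₛ-cong (λ S → cong (λ b → if b then sgn S else 0ℤ) (P≗Q S))

signedCount-∷ : (P : Subset (suc m) → Bool) →
  signedCount P ≡ signedCount (P ∘ (outside ∷_)) - signedCount (P ∘ (inside ∷_))
signedCount-∷ P = cong (signedCount (P ∘ (outside ∷_)) +_) (begin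
  ∑ₛ (λ S → if P (inside ∷ S) then - sgn S else 0ℤ)    ≡⟨ ∑ₛ-cong (λ S → sym (if-float -_ (P (inside ∷ S)))) ⟩
  ∑ₛ (λ S → - (if P (inside ∷ S) then sgn S else 0ℤ))  ≡⟨ ∑ₛ-neg (λ S → if P (inside ∷ S) then sgn S else 0ℤ) ⟩
  - signedCount (P ∘ (inside ∷_))                       ∎)
  where open ≡-Reasoning

Recurrent : (ℕ → ℤ) → Set
Recurrent x = ∀ m → x (suc (suc m)) ≡ x (suc m) - x m

Recurrent-− : {x y : ℕ → ℤ} → Recurrent x → Recurrent y → Recurrent (λ m → x m - y m)
Recurrent-− {x} {y} x-rec y-rec m =
  trans (cong₂ _-_ (x-rec m) (y-rec m)) (interchange (x (suc m)) (x m) (y (suc m)) (y m))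
  where
  interchange : ∀ a b c d → (a - b) - (c - d) ≡ (a - c) - (b - d)
  interchange = solve-∀

recurrent⇒antiperiodic : {x : ℕ → ℤ} → Recurrent x → ∀ m → x (3 ℕ.+ m) ≡ - x m
recurrent⇒antiperiodic {x} x-rec m =
  trans (x-rec (suc m)) (trans (cong (_- x (suc m)) (x-rec m)) (cancel (x (suc m)) (x m)))
  where
  cancel : ∀ a b → (a - b) - a ≡ - b
  cancel = solve-∀

recurrent-≢0 : {x : ℕ → ℤ} → Recurrent x → ∀ q {r} → x r ≢ 0ℤ → x (q ℕ.* 3 ℕ.+ r) ≢ 0ℤ
recurrent-≢0 x-rec zero xr≢0 = xr≢0
recurrent-≢0 {x} x-rec (suc q) {r} xr≢0 x≡0 =
  recurrent-≢0 {x} x-rec q xr≢0 (neg-injective (trans (sym (recurrent⇒antiperiodic {x} x-rec (q ℕ.* 3 ℕ.+ r))) x≡0))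

record PathLike (P : ∀ {m} → Subset m → Bool) : Set where
  field
    outside-∷        : (S : Subset m) → P (outside ∷ S) ≡ P S
    inside-∷-inside  : (S : Subset m) → P (inside ∷ inside ∷ S) ≡ false
    inside-∷-outside : (S : Subset m) → P (inside ∷ outside ∷ S) ≡ P S

signedCount-recurrent : {P : ∀ {m} → Subset m → Bool} → PathLike P → Recurrent (λ m → signedCount (P {m}))
signedCount-recurrent {P} pathLike m = begin
  signedCount P₂
    ≡⟨ signedCount-∷ P₂ ⟩
  signedCount (P₂ ∘ (outside ∷_)) - signedCount (P₂ ∘ (inside ∷_))
    ≡⟨ cong (λ z → signedCount (P₂ ∘ (outside ∷_)) - z) (signedCount-∷ (P₂ ∘ (inside ∷_))) ⟩
  signedCount (P₂ ∘ (outside ∷_))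
    - (signedCount (P₂ ∘ (inside ∷_) ∘ (outside ∷_)) - signedCount (P₂ ∘ (inside ∷_) ∘ (inside ∷_)))
    ≡⟨ cong₂ _-_ (signedCount-cong {suc m} outside-∷)
                 (cong₂ _-_ (signedCount-cong {m} inside-∷-outside)
                            (trans (signedCount-cong {m} inside-∷-inside) (∑ₛ-zero {m}))) ⟩
  signedCount (P {suc m}) - (signedCount (P {m}) - 0ℤ)
    ≡⟨ cong (λ z → signedCount (P {suc m}) - z) (+-identityʳ _) ⟩
  signedCount (P {suc m}) - signedCount (P {m})
    ∎
  where
  open PathLike pathLike
  open ≡-Reasoning
  P₂ = P {suc (suc m)}

pathIndependentᵇ : Subset m → Bool
pathIndependentᵇ [] = true
pathIndependentᵇ (outside ∷ S) = pathIndependentᵇ S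
pathIndependentᵇ (inside ∷ []) = true
pathIndependentᵇ (inside ∷ inside ∷ S) = false
pathIndependentᵇ (inside ∷ outside ∷ S) = pathIndependentᵇ S

pathIndependentᵇ-tail : (b : Bool) (S : Subset m) → pathIndependentᵇ (b ∷ S) ≡ true → pathIndependentᵇ S ≡ true
pathIndependentᵇ-tail outside S ok = ok
pathIndependentᵇ-tail inside [] ok = refl
pathIndependentᵇ-tail inside (outside ∷ S) ok = ok

pathIndependentᵇ-no-successor : (S : Subset m) → pathIndependentᵇ S ≡ true →
  ∀ i j → i ∈ S → j ∈ S → suc (toℕ i) ≢ toℕ j
pathIndependentᵇ-no-successor (inside ∷ inside ∷ S) () zero (suc zero) here (there here) _
pathIndependentᵇ-no-successor (inside ∷ outside ∷ S) _ zero (suc zero) _ (there ()) _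
pathIndependentᵇ-no-successor _ _ zero zero _ _ ()
pathIndependentᵇ-no-successor _ _ zero (suc (suc _)) _ _ ()
pathIndependentᵇ-no-successor _ _ (suc _) zero _ _ ()
pathIndependentᵇ-no-successor (b ∷ S) ok (suc i) (suc j) (there i∈S) (there j∈S) i+1≡j =
  pathIndependentᵇ-no-successor S (pathIndependentᵇ-tail b S ok) i j i∈S j∈S (suc-injective i+1≡j)

pathIndependentᵇ-sound : (S : Subset m) → pathIndependentᵇ S ≡ true → Independent (pathAdj m) S
pathIndependentᵇ-sound S ok i j i∈S j∈S (inj₁ i+1≡j) = pathIndependentᵇ-no-successor S ok i j i∈S j∈S i+1≡j
pathIndependentᵇ-sound S ok i j i∈S j∈S (inj₂ j+1≡i) = pathIndependentᵇ-no-successor S ok j i j∈S i∈S j+1≡i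

path-independent-tail : (b : Bool) (S : Subset m) → Independent (pathAdj (suc m)) (b ∷ S) → Independent (pathAdj m) S
path-independent-tail b S independent i j i∈S j∈S i~j =
  independent (suc i) (suc j) (there i∈S) (there j∈S) (Sum.map (cong suc) (cong suc) i~j)

pathIndependentᵇ-complete : (S : Subset m) → Independent (pathAdj m) S → pathIndependentᵇ S ≡ true
pathIndependentᵇ-complete [] _ = refl
pathIndependentᵇ-complete (outside ∷ S) independent =
  pathIndependentᵇ-complete S (path-independent-tail outside S independent)
pathIndependentᵇ-complete (inside ∷ []) _ = refl
pathIndependentᵇ-complete (inside ∷ inside ∷ S) independent =
  ⊥-elim (independent zero (suc zero) here (there here) (inj₁ refl))
pathIndependentᵇ-complete (inside ∷ outside ∷ S) independent =
  pathIndependentᵇ-complete S (path-independent-tail outside S (path-independent-tail inside (outside ∷ S) independent))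

pathIndependentᵇ-correct : (S : Subset m) → pathIndependentᵇ S ≡ true ⇔ Independent (pathAdj m) S
pathIndependentᵇ-correct S = mk⇔ (pathIndependentᵇ-sound S) (pathIndependentᵇ-complete S)

pathIndependentᵇ-pathLike : PathLike pathIndependentᵇ
pathIndependentᵇ-pathLike = record
  { outside-∷ = λ _ → refl ; inside-∷-inside = λ _ → refl ; inside-∷-outside = λ _ → refl }

pathCount : ℕ → ℤ
pathCount m = signedCount (pathIndependentᵇ {m})

pathCount-recurrent : Recurrent pathCount
pathCount-recurrent = signedCount-recurrent pathIndependentᵇ-pathLike

-- pathCount 0 = 1 and pathCount 2 = -1, whereas pathCount 1 = 0.
pathCount-3n≢0 : ∀ n → pathCount (3 * n) ≢ 0ℤ
pathCount-3n≢0 n = subst (λ k → pathCount k ≢ 0ℤ) (trans (ℕ.+-identityʳ (n * 3)) (ℕ.*-comm n 3))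
  (recurrent-≢0 {pathCount} pathCount-recurrent n {0} λ ())

pathCount-3[1+n]∸1≢0 : ∀ n → pathCount (3 * suc n ∸ 1) ≢ 0ℤ
pathCount-3[1+n]∸1≢0 n = subst (λ k → pathCount k ≢ 0ℤ) (trans (ℕ.+-comm (n * 3) 2) (cong (_∸ 1) (ℕ.*-comm (suc n) 3)))
  (recurrent-≢0 {pathCount} pathCount-recurrent n {2} λ ())

endsInsideᵇ : Subset m → Bool
endsInsideᵇ [] = false
endsInsideᵇ (b ∷ []) = b
endsInsideᵇ (_ ∷ b ∷ S) = endsInsideᵇ (b ∷ S)

endsInsideᵇ-sound : (S : Subset (suc m)) → endsInsideᵇ S ≡ true → fromℕ m ∈ S
endsInsideᵇ-sound (inside ∷ []) _ = here
endsInsideᵇ-sound (_ ∷ b ∷ S) ends = there (endsInsideᵇ-sound (b ∷ S) ends)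

endsInsideᵇ-complete : (S : Subset (suc m)) → fromℕ m ∈ S → endsInsideᵇ S ≡ true
endsInsideᵇ-complete (inside ∷ []) here = refl
endsInsideᵇ-complete (_ ∷ b ∷ S) (there last∈S) = endsInsideᵇ-complete (b ∷ S) last∈S

endsInsideᵇ-outside-∷ : (S : Subset m) → endsInsideᵇ (outside ∷ S) ≡ endsInsideᵇ S
endsInsideᵇ-outside-∷ [] = refl
endsInsideᵇ-outside-∷ (_ ∷ _) = refl

pathEndsOutsideᵇ : Subset m → Bool
pathEndsOutsideᵇ S = pathIndependentᵇ S ∧ not (endsInsideᵇ S)

pathEndsOutsideᵇ-pathLike : PathLike pathEndsOutsideᵇ
pathEndsOutsideᵇ-pathLike = record
  { outside-∷ = drop-outside ; inside-∷-inside = λ _ → refl ; inside-∷-outside = drop-outside }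
  where
  drop-outside : (S : Subset m) → pathIndependentᵇ S ∧ not (endsInsideᵇ (outside ∷ S)) ≡ pathEndsOutsideᵇ S
  drop-outside S = cong (λ b → pathIndependentᵇ S ∧ not b) (endsInsideᵇ-outside-∷ S)

pathEndsOutsideCount : ℕ → ℤ
pathEndsOutsideCount m = signedCount (pathEndsOutsideᵇ {m})

pathEndsOutsideCount-recurrent : Recurrent pathEndsOutsideCount
pathEndsOutsideCount-recurrent = signedCount-recurrent pathEndsOutsideᵇ-pathLike

cycleIndependentᵇ : Subset m → Bool
cycleIndependentᵇ [] = true
cycleIndependentᵇ (outside ∷ S) = pathIndependentᵇ S
cycleIndependentᵇ (inside ∷ S) = pathIndependentᵇ (inside ∷ S) ∧ not (endsInsideᵇ S)

cycleIndependentᵇ⇒pathIndependentᵇ : (S : Subset m) → cycleIndependentᵇ S ≡ true → pathIndependentᵇ S ≡ true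
cycleIndependentᵇ⇒pathIndependentᵇ [] _ = refl
cycleIndependentᵇ⇒pathIndependentᵇ (outside ∷ S) ok = ok
cycleIndependentᵇ⇒pathIndependentᵇ (inside ∷ S) ok = ∧-conicalˡ _ _ ok

cycleIndependentᵇ-ends : (S : Subset (suc (suc m))) → cycleIndependentᵇ S ≡ true →
  ∀ i j → i ∈ S → j ∈ S → toℕ i ≡ 0 → toℕ j ≡ suc m → ⊥
cycleIndependentᵇ-ends {m} (inside ∷ S) ok zero (suc j) here (there j∈S) _ j-last =
  contradiction (subst (λ b → not b ≡ true) (endsInsideᵇ-complete S last∈S) (∧-conicalʳ _ _ ok)) λ ()
  where
  last∈S : fromℕ m ∈ S
  last∈S = subst (_∈ S) (toℕ-injective (trans (suc-injective j-last) (sym (toℕ-fromℕ m)))) j∈S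
cycleIndependentᵇ-ends (inside ∷ S) ok zero zero here _ _ ()

cycleIndependentᵇ-sound : (S : Subset (suc (suc m))) → cycleIndependentᵇ S ≡ true →
  Independent (cycleAdj (suc (suc m))) S
cycleIndependentᵇ-sound S ok i j i∈S j∈S (inj₁ i~j) =
  pathIndependentᵇ-sound S (cycleIndependentᵇ⇒pathIndependentᵇ S ok) i j i∈S j∈S i~j
cycleIndependentᵇ-sound S ok i j i∈S j∈S (inj₂ (inj₁ (i≡0 , j-last))) =
  cycleIndependentᵇ-ends S ok i j i∈S j∈S i≡0 (suc-injective j-last)
cycleIndependentᵇ-sound S ok i j i∈S j∈S (inj₂ (inj₂ (j≡0 , i-last))) =
  cycleIndependentᵇ-ends S ok j i j∈S i∈S j≡0 (suc-injective i-last)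

cycle⇒path-independent : (S : Subset m) → Independent (cycleAdj m) S → Independent (pathAdj m) S
cycle⇒path-independent S independent i j i∈S j∈S i~j = independent i j i∈S j∈S (inj₁ i~j)

cycleIndependentᵇ-complete : (S : Subset (suc (suc m))) → Independent (cycleAdj (suc (suc m))) S →
  cycleIndependentᵇ S ≡ true
cycleIndependentᵇ-complete (outside ∷ S) independent =
  pathIndependentᵇ-complete S (path-independent-tail outside S (cycle⇒path-independent (outside ∷ S) independent))
cycleIndependentᵇ-complete {m} (inside ∷ S) independent =
  cong₂ _∧_ (pathIndependentᵇ-complete (inside ∷ S) (cycle⇒path-independent (inside ∷ S) independent))
            (cong not (¬-not last∉S))
  where
  last∉S : endsInsideᵇ S ≢ true
  last∉S ends = independent zero (suc (fromℕ m)) here (there (endsInsideᵇ-sound S ends))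
                            (inj₂ (inj₁ (refl , cong (ℕ.suc ∘ ℕ.suc) (toℕ-fromℕ m))))

cycleIndependentᵇ-correct : (S : Subset (suc (suc m))) →
  cycleIndependentᵇ S ≡ true ⇔ Independent (cycleAdj (suc (suc m))) S
cycleIndependentᵇ-correct S = mk⇔ (cycleIndependentᵇ-sound S) (cycleIndependentᵇ-complete S)

cycleCount : ℕ → ℤ
cycleCount m = signedCount (cycleIndependentᵇ {m})

cycleCount≡pathCount-pathEndsOutsideCount : ∀ m →
  cycleCount (3 ℕ.+ m) ≡ pathCount (2 ℕ.+ m) - pathEndsOutsideCount (1 ℕ.+ m)
cycleCount≡pathCount-pathEndsOutsideCount m = begin
  cycleCount (3 ℕ.+ m)
    ≡⟨ signedCount-∷ P ⟩
  pathCount (2 ℕ.+ m) - signedCount (P ∘ (inside ∷_))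
    ≡⟨ cong (λ z → pathCount (2 ℕ.+ m) - z) (signedCount-∷ (P ∘ (inside ∷_))) ⟩
  pathCount (2 ℕ.+ m) - (signedCount (P ∘ (inside ∷_) ∘ (outside ∷_)) - signedCount {1 ℕ.+ m} (λ _ → false))
    ≡⟨ cong₂ (λ x y → pathCount (2 ℕ.+ m) - (x - y)) (signedCount-cong {1 ℕ.+ m} inside-∷-outside) (∑ₛ-zero {1 ℕ.+ m}) ⟩
  pathCount (2 ℕ.+ m) - (pathEndsOutsideCount (1 ℕ.+ m) - 0ℤ)
    ≡⟨ cong (λ z → pathCount (2 ℕ.+ m) - z) (+-identityʳ _) ⟩
  pathCount (2 ℕ.+ m) - pathEndsOutsideCount (1 ℕ.+ m)
    ∎
  where
  open PathLike pathEndsOutsideᵇ-pathLike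
  open ≡-Reasoning
  P = cycleIndependentᵇ {3 ℕ.+ m}

cycleCount-recurrent : Recurrent (λ m → cycleCount (3 ℕ.+ m))
cycleCount-recurrent m = begin
  cycleCount (5 ℕ.+ m)
    ≡⟨ cycleCount≡pathCount-pathEndsOutsideCount (2 ℕ.+ m) ⟩
  pathCount (4 ℕ.+ m) - pathEndsOutsideCount (3 ℕ.+ m)
    ≡⟨ difference-recurrent m ⟩
  (pathCount (3 ℕ.+ m) - pathEndsOutsideCount (2 ℕ.+ m)) - (pathCount (2 ℕ.+ m) - pathEndsOutsideCount (1 ℕ.+ m))
    ≡⟨ sym (cong₂ _-_ (cycleCount≡pathCount-pathEndsOutsideCount (1 ℕ.+ m))
                      (cycleCount≡pathCount-pathEndsOutsideCount m)) ⟩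
  cycleCount (4 ℕ.+ m) - cycleCount (3 ℕ.+ m)
    ∎
  where
  open ≡-Reasoning
  difference-recurrent : Recurrent (λ k → pathCount (2 ℕ.+ k) - pathEndsOutsideCount (1 ℕ.+ k))
  difference-recurrent = Recurrent-− {λ k → pathCount (2 ℕ.+ k)} {λ k → pathEndsOutsideCount (1 ℕ.+ k)}
    (pathCount-recurrent ∘ (2 ℕ.+_)) (pathEndsOutsideCount-recurrent ∘ (1 ℕ.+_))

cycleCount≢0 : ∀ m → cycleCount (3 ℕ.+ m) ≢ 0ℤ
cycleCount≢0 m = subst (λ k → cycleCount (3 ℕ.+ k) ≢ 0ℤ) (sym m≡[m/3]*3+m%3)
  (recurrent-≢0 {λ k → cycleCount (3 ℕ.+ k)} cycleCount-recurrent (m / 3) (initial≢0 (m % 3) (m%n<n m 3)))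
  where
  m≡[m/3]*3+m%3 : m ≡ (m / 3) ℕ.* 3 ℕ.+ m % 3
  m≡[m/3]*3+m%3 = trans (m≡m%n+[m/n]*n m 3) (ℕ.+-comm (m % 3) _)
  -- cycleCount 3, 4, 5 are -2, -1, 1.
  initial≢0 : ∀ r → r ℕ.< 3 → cycleCount (3 ℕ.+ r) ≢ 0ℤ
  initial≢0 0 _ = λ ()
  initial≢0 1 _ = λ ()
  initial≢0 2 _ = λ ()
  initial≢0 (suc (suc (suc _))) (ℕ.s≤s (ℕ.s≤s (ℕ.s≤s ())))

cyclicSucc-pred : (i : Fin (suc N)) → ∃ λ j → CyclicSucc (suc N) j i
cyclicSucc-pred {N} zero = fromℕ N , inj₂ (cong ℕ.suc (toℕ-fromℕ N) , refl)
cyclicSucc-pred (suc i) = inject₁ i , inj₁ (cong ℕ.suc (toℕ-inject₁ i))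

cyclicSucc-succ : (i : Fin (suc N)) → ∃ λ k → CyclicSucc (suc N) i k
cyclicSucc-succ {N} i with ℕ.suc (toℕ i) ℕ.<? suc N
... | yes i+1<N = fromℕ< i+1<N , inj₁ (sym (toℕ-fromℕ< i+1<N))
... | no  i+1≮N = zero , inj₂ (ℕ.≤-antisym (toℕ<n i) (ℕ.≮⇒≥ i+1≮N) , refl)

cyclicSucc-2-cycle : {i j : Fin N} → CyclicSucc N i j → CyclicSucc N j i → N ℕ.≤ 2
cyclicSucc-2-cycle {i = i} (inj₁ i+1≡j) (inj₁ j+1≡i) =
  ⊥-elim (ℕ.m≢1+n+m (toℕ i) {1} (trans (sym j+1≡i) (cong ℕ.suc (sym i+1≡j))))
cyclicSucc-2-cycle (inj₁ i+1≡j) (inj₂ (j+1≡N , i≡0)) =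
  ℕ.≤-reflexive (trans (sym j+1≡N) (cong ℕ.suc (trans (sym i+1≡j) (cong ℕ.suc i≡0))))
cyclicSucc-2-cycle (inj₂ (i+1≡N , j≡0)) (inj₁ j+1≡i) =
  ℕ.≤-reflexive (trans (sym i+1≡N) (cong ℕ.suc (trans (sym j+1≡i) (cong ℕ.suc j≡0))))
cyclicSucc-2-cycle (inj₂ (i+1≡N , _)) (inj₂ (_ , i≡0)) =
  ℕ.m≤n⇒m≤1+n (ℕ.≤-reflexive (trans (sym i+1≡N) (cong ℕ.suc i≡0)))

module _ (G : Graph) where
  open Graph G

  hamiltonian⇒two-neighbours : Hamiltonian G → ∀ v → IsVertex v →
    ∃ λ u → ∃ λ w → IsVertex u × IsVertex w × Adj u v × Adj v w × u ≢ w
  hamiltonian⇒two-neighbours (suc N , 3≤N , f , f-vertex , f-inj , f-onto , f-cycle) v v-vertex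
    with f-onto v v-vertex
  ... | i , refl =
    let j , j→i = cyclicSucc-pred i
        k , i→k = cyclicSucc-succ i
    in f j , f k , f-vertex j , f-vertex k , f-cycle j i j→i , f-cycle i k i→k ,
       λ fj≡fk → ℕ.<⇒≱ 3≤N (cyclicSucc-2-cycle j→i (subst (CyclicSucc (suc N) i) (sym (f-inj fj≡fk)) i→k))

⁅⁆-independent : (adj : AdjRel m) (x : Fin m) → ¬ adj x x → Independent adj ⁅ x ⁆
⁅⁆-independent adj x ¬x~x i j i∈⁅x⁆ j∈⁅x⁆ with x∈⁅y⁆⇒x≡y x i∈⁅x⁆ | x∈⁅y⁆⇒x≡y x j∈⁅x⁆
... | refl | refl = ¬x~x

∪⁅⁆≡⁅⁆⇒≡∅ : (T : Subset m) (x y : Fin m) → y ∉ T → ⁅ x ⁆ ≡ T ∪ ⁅ y ⁆ → T ≡ ∅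
∪⁅⁆≡⁅⁆⇒≡∅ T x y y∉T ⁅x⁆≡T∪⁅y⁆ = ⊆-antisym T⊆∅ ⊥⊆
  where
  ≡x : ∀ {z} → z ∈ T ∪ ⁅ y ⁆ → z ≡ x
  ≡x z∈ = x∈⁅y⁆⇒x≡y x (subst (_ ∈_) (sym ⁅x⁆≡T∪⁅y⁆) z∈)
  T⊆∅ : T ⊆ ∅
  T⊆∅ z∈T = ⊥-elim (y∉T (subst (_∈ T) (trans (≡x (p⊆p∪q ⁅ y ⁆ z∈T)) (sym (≡x (q⊆p∪q T ⁅ y ⁆ (x∈⁅x⁆ y))))) z∈T))

dominating-⁅⁆-neighbour≡∅ : (adj : AdjRel m) (x : Fin m) → (∀ y → y ≢ x → adj x y) →
  (T : Subset m) → Independent adj T → AddOne ⁅ x ⁆ T ⊎ AddOne T ⁅ x ⁆ → T ≡ ∅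
dominating-⁅⁆-neighbour≡∅ adj x dominating T T-independent (inj₁ (y , y∉⁅x⁆ , refl)) =
  ⊥-elim (T-independent x y (p⊆p∪q ⁅ y ⁆ (x∈⁅x⁆ x)) (q⊆p∪q ⁅ x ⁆ ⁅ y ⁆ (x∈⁅x⁆ y))
                        (dominating y (x∉⁅y⁆⇒x≢y y∉⁅x⁆)))
dominating-⁅⁆-neighbour≡∅ adj x dominating T T-independent (inj₂ (y , y∉T , ⁅x⁆≡T∪⁅y⁆)) =
  ∪⁅⁆≡⁅⁆⇒≡∅ T x y y∉T ⁅x⁆≡T∪⁅y⁆

dominating⇒¬hamiltonian : (adj : AdjRel m) (a : ℕ) (x : Fin m) → ¬ adj x x → (∀ y → y ≢ x → adj x y) →
  (∀ S → Independent adj S → ∣ S ∣ ≤ a) → ¬ Hamiltonian (kIndependentGraph a adj)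
dominating⇒¬hamiltonian adj a x ¬x~x dominating α≤a H
  with hamiltonian⇒two-neighbours (kIndependentGraph a adj) H ⁅ x ⁆ (⁅x⁆-independent , α≤a ⁅ x ⁆ ⁅x⁆-independent)
  where ⁅x⁆-independent = ⁅⁆-independent adj x ¬x~x
... | u , w , (u-independent , _) , (w-independent , _) , u~⁅x⁆ , ⁅x⁆~w , u≢w =
  u≢w (trans (dominating-⁅⁆-neighbour≡∅ adj x dominating u u-independent (Sum.swap u~⁅x⁆))
             (sym (dominating-⁅⁆-neighbour≡∅ adj x dominating w w-independent ⁅x⁆~w)))

wheelAdj-hub-irreflexive : ¬ wheelAdj (suc m) zero zero
wheelAdj-hub-irreflexive (inj₁ (_ , 0≢0)) = 0≢0 refl
wheelAdj-hub-irreflexive (inj₂ (inj₁ (_ , 0≢0))) = 0≢0 refl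
wheelAdj-hub-irreflexive (inj₂ (inj₂ (inj₁ (0≢0 , _)))) = 0≢0 refl
wheelAdj-hub-irreflexive (inj₂ (inj₂ (inj₂ (inj₁ (() , _)))))
wheelAdj-hub-irreflexive (inj₂ (inj₂ (inj₂ (inj₂ (() , _)))))

wheelAdj-hub-dominating : (y : Fin (suc m)) → y ≢ zero → wheelAdj (suc m) zero y
wheelAdj-hub-dominating y y≢0 = inj₁ (refl , y≢0 ∘ toℕ-injective)

path-¬hamiltonian : (m a : ℕ) → (∀ S → Independent (pathAdj m) S → ∣ S ∣ ≤ a) → pathCount m ≢ 0ℤ →
  ¬ Hamiltonian (kIndependentGraph a (pathAdj m))
path-¬hamiltonian m a α≤a count≢0 =
  count≢0 ∘ hamiltonian⇒signedCount≡0 (pathAdj m) a pathIndependentᵇ pathIndependentᵇ-correct α≤a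

cycle-¬hamiltonian : (m a : ℕ) → (∀ S → Independent (cycleAdj (3 ℕ.+ m)) S → ∣ S ∣ ≤ a) →
  ¬ Hamiltonian (kIndependentGraph a (cycleAdj (3 ℕ.+ m)))
cycle-¬hamiltonian m a α≤a =
  cycleCount≢0 m ∘ hamiltonian⇒signedCount≡0 (cycleAdj (3 ℕ.+ m)) a cycleIndependentᵇ cycleIndependentᵇ-correct α≤a

wheel-¬hamiltonian : (m a : ℕ) → (∀ S → Independent (wheelAdj (suc m)) S → ∣ S ∣ ≤ a) →
  ¬ Hamiltonian (kIndependentGraph a (wheelAdj (suc m)))
wheel-¬hamiltonian m a =
  dominating⇒¬hamiltonian (wheelAdj (suc m)) a zero wheelAdj-hub-irreflexive wheelAdj-hub-dominating

corollary2p5 :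
    ((n : ℕ) → 1 ≤ n →
       ((a : ℕ) → IsIndependenceNumber (pathAdj (3 * n ∸ 1)) a →
          ¬ Hamiltonian (kIndependentGraph a (pathAdj (3 * n ∸ 1))))
     × ((a : ℕ) → IsIndependenceNumber (pathAdj (3 * n)) a →
          ¬ Hamiltonian (kIndependentGraph a (pathAdj (3 * n)))))
    × ((n : ℕ) → 3 ≤ n → (a : ℕ) → IsIndependenceNumber (cycleAdj n) a →
         ¬ Hamiltonian (kIndependentGraph a (cycleAdj n)))
    × ((n : ℕ) → 4 ≤ n → (a : ℕ) → IsIndependenceNumber (wheelAdj n) a →
         ¬ Hamiltonian (kIndependentGraph a (wheelAdj n)))
corollary2p5 =
    (λ { (suc n) _ → (λ a (_ , α≤a) → path-¬hamiltonian _ a α≤a (pathCount-3[1+n]∸1≢0 n))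
                   , (λ a (_ , α≤a) → path-¬hamiltonian _ a α≤a (pathCount-3n≢0 (suc n))) })
  , (λ { (suc zero) (ℕ.s≤s ())
       ; (suc (suc zero)) (ℕ.s≤s (ℕ.s≤s ()))
       ; (suc (suc (suc m))) _ a (_ , α≤a) → cycle-¬hamiltonian m a α≤a })
  , (λ { (suc m) _ a (_ , α≤a) → wheel-¬hamiltonian m a α≤a })
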